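{- Let $r\geq 4$ and let $M_r$ be the matrix indexed by subsets of $[r]$ with $M_r(S,T)=\binom{|S\cap T|}{2}+\binom{|\overline{S}\cap\overline{T}|}{2}$, $\overline{S}=[r]\setminus S$. For distinct $x,y\in[r]$, define $V\in\mathbb{R}^{\mathcal{P}([r])}$ by $V_T=(r-2|T|)(T(x)-T(y))$, where $T(u)=1$ if $u\in T$ and $0$ otherwise. Then $V$ is an eigenvector of $M_r$ with eigenvalue $2^{r-3}$.
   Context: $\mathcal{P}([r])$ is the power set of $[r]=\{1,\ldots,r\}$. -}

module Defs where

open import Data.Nat using (ℕ; zero; suc)
open import Data.Nat.Combinatorics using (_C_)
open import Data.Bool using (Bool; true; false)
open import Data.Fin using (Fin)
open import Data.Fin.Subset using (Subset; _∩_; ∁; ∣_∣)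
open import Data.Vec using (Vec; []; _∷_; lookup)
open import Data.List using (List; []; _∷_; map; _++_)
open import Data.Integer using (ℤ; +_; _-_; _*_)
import Data.Integer as ℤ

-- Enumeration of the power set P([r]) as subsets (characteristic vectors) of Fin r.
-- Each subset occurs exactly once.
allSubsets : (r : ℕ) → List (Subset r)
allSubsets zero = [] ∷ []
allSubsets (suc r) = map (false ∷_) (allSubsets r) ++ map (true ∷_) (allSubsets r)

sumℤ : List ℤ → ℤ
sumℤ [] = + 0
sumℤ (x ∷ xs) = x ℤ.+ sumℤ xs

M : (r : ℕ) → Subset r → Subset r → ℤ
M r S T = + ((∣ S ∩ T ∣ C 2) Data.Nat.+ (∣ ∁ S ∩ ∁ T ∣ C 2))

ind : {r : ℕ} → Subset r → Fin r → ℤ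
ind T u with lookup T u
... | true = + 1
... | false = + 0

V : (r : ℕ) → Fin r → Fin r → Subset r → ℤ
V r x y T = ((+ r) - (+ 2) * (+ ∣ T ∣)) * (ind T x - ind T y)

MV : (r : ℕ) → (Subset r → ℤ) → Subset r → ℤ
MV r W S = sumℤ (map (λ T → M r S T * W T) (allSubsets r))

-- Complementation T ↦ T̄ fixes V, and (S, T) ↦ (S̄, T̄) exchanges the two binomials of M_r, so
-- (M_r V)(S) = H(S) + H(S̄) with H(S) = Σ_T C(|S ∩ T|, 2) V_T. Peeling off one coordinate at a time
-- shows that the sums over T of T(x) q(|S ∩ T|, |T|), for q in the span of 1, c, a, ac, C(a, 2) and
-- C(a, 2) c, are polynomials in r, |S| and S(x). For H this gives
-- H(S) = 2^(r−3) (1 − |S|) (S(x) − S(y)), and adding H(S̄), where |S̄| = r − |S| and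
-- S̄(u) = 1 − S(u), yields 2^(r−3) V_S.
module Submission where

open import Defs
open import Data.Nat using (ℕ; _≤_; _∸_; _^_)
open import Data.Fin using (Fin)
open import Data.Fin.Subset using (Subset)
open import Data.Integer using (ℤ; +_; _*_)
open import Data.Product using (_×_; ∃)
open import Relation.Binary.PropositionalEquality using (_≡_; _≢_)

import Data.Nat as ℕ
open import Data.Nat using (zero; suc; s≤s)
open import Data.Nat.Combinatorics using (_C_; nCk+nC[k+1]≡[n+1]C[k+1]; nC1≡n)
import Data.Nat.Properties as ℕ
open import Data.Integer using (_+_; _-_; -_; _⊖_)
open import Data.Integer.Properties
  using (+-identityˡ; +-assoc; +-comm; *-assoc; *-comm; *-identityˡ; *-identityʳ; *-distribˡ-+;
         *-distribʳ-+; *-cancelˡ-≡; pos-*; m-n≡m⊖n; ⊖-≥)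
open import Data.Integer.Tactic.RingSolver using (solve-∀)
open import Data.Bool using (true; false)
open import Data.Fin using () renaming (zero to fzero; suc to fsuc)
open import Data.Fin.Subset using (_∩_; ∁; ∣_∣; ⁅_⁆; ⊥)
open import Data.Fin.Subset.Properties using (∣∁p∣≡n∸∣p∣; ∣p∣≤n; ∣⁅x⁆∣≡1)
open import Data.Vec using ([]; _∷_)
open import Data.List using (List; []; _∷_; map; _++_)
open import Data.List.Properties using (map-++; map-∘; map-cong)
open import Data.Product using (_,_)
open import Data.Empty using (⊥-elim)
open import Function using (_∘_; case_of_)
open import Relation.Binary.PropositionalEquality
  using (refl; sym; trans; cong; cong₂; subst; module ≡-Reasoning)

open ≡-Reasoning

private
  variable
    A : Set
    n : ℕ

sumℤ-++ : (xs ys : List ℤ) → sumℤ (xs ++ ys) ≡ sumℤ xs + sumℤ ys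
sumℤ-++ []       ys = sym (+-identityˡ (sumℤ ys))
sumℤ-++ (x ∷ xs) ys = trans (cong (_+_ x) (sumℤ-++ xs ys)) (sym (+-assoc x (sumℤ xs) (sumℤ ys)))

sumℤ-map-+ : (f g : A → ℤ) (xs : List A) →
             sumℤ (map (λ a → f a + g a) xs) ≡ sumℤ (map f xs) + sumℤ (map g xs)
sumℤ-map-+ f g []       = refl
sumℤ-map-+ f g (x ∷ xs) = trans (cong (_+_ (f x + g x)) (sumℤ-map-+ f g xs))
                                 (interchange (f x) (g x) (sumℤ (map f xs)) (sumℤ (map g xs)))
  where
  interchange : ∀ a b c d → a + b + (c + d) ≡ a + c + (b + d)
  interchange = solve-∀

sumℤ-map-- : (f g : A → ℤ) (xs : List A) →
             sumℤ (map (λ a → f a - g a) xs) ≡ sumℤ (map f xs) - sumℤ (map g xs)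
sumℤ-map-- f g []       = refl
sumℤ-map-- f g (x ∷ xs) = trans (cong (_+_ (f x - g x)) (sumℤ-map-- f g xs))
                                 (interchange (f x) (g x) (sumℤ (map f xs)) (sumℤ (map g xs)))
  where
  interchange : ∀ a b c d → a - b + (c - d) ≡ a + c - (b + d)
  interchange = solve-∀

sumSubsets : (n : ℕ) → (Subset n → ℤ) → ℤ
sumSubsets n f = sumℤ (map f (allSubsets n))

sumSubsets-cong : {f g : Subset n → ℤ} → (∀ T → f T ≡ g T) → sumSubsets n f ≡ sumSubsets n g
sumSubsets-cong {n} f≗g = cong sumℤ (map-cong f≗g (allSubsets n))

sumSubsets-suc : (f : Subset (suc n) → ℤ) →
                 sumSubsets (suc n) f ≡ sumSubsets n (f ∘ (false ∷_)) + sumSubsets n (f ∘ (true ∷_))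
sumSubsets-suc {n} f = begin
  sumℤ (map f (map (false ∷_) L ++ map (true ∷_) L))
    ≡⟨ cong sumℤ (map-++ f (map (false ∷_) L) (map (true ∷_) L)) ⟩
  sumℤ (map f (map (false ∷_) L) ++ map f (map (true ∷_) L))
    ≡⟨ sumℤ-++ (map f (map (false ∷_) L)) (map f (map (true ∷_) L)) ⟩
  sumℤ (map f (map (false ∷_) L)) + sumℤ (map f (map (true ∷_) L))
    ≡⟨ cong₂ _+_ (cong sumℤ (sym (map-∘ L))) (cong sumℤ (sym (map-∘ L))) ⟩
  sumSubsets n (f ∘ (false ∷_)) + sumSubsets n (f ∘ (true ∷_)) ∎
  where L = allSubsets n

sumSubsets-+ : (f g : Subset n → ℤ) →
               sumSubsets n (λ T → f T + g T) ≡ sumSubsets n f + sumSubsets n g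
sumSubsets-+ {n} f g = sumℤ-map-+ f g (allSubsets n)

sumSubsets-- : (f g : Subset n → ℤ) →
               sumSubsets n (λ T → f T - g T) ≡ sumSubsets n f - sumSubsets n g
sumSubsets-- {n} f g = sumℤ-map-- f g (allSubsets n)

-- Complementing the first coordinate swaps the two halves of the enumeration.
sumSubsets-∁ : (f : Subset n → ℤ) → sumSubsets n (f ∘ ∁) ≡ sumSubsets n f
sumSubsets-∁ {zero}  f = refl
sumSubsets-∁ {suc n} f = begin
  sumSubsets (suc n) (f ∘ ∁)
    ≡⟨ sumSubsets-suc (f ∘ ∁) ⟩
  sumSubsets n (f ∘ (true ∷_) ∘ ∁) + sumSubsets n (f ∘ (false ∷_) ∘ ∁)
    ≡⟨ cong₂ _+_ (sumSubsets-∁ (f ∘ (true ∷_))) (sumSubsets-∁ (f ∘ (false ∷_))) ⟩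
  sumSubsets n (f ∘ (true ∷_)) + sumSubsets n (f ∘ (false ∷_))
    ≡⟨ +-comm (sumSubsets n (f ∘ (true ∷_))) (sumSubsets n (f ∘ (false ∷_))) ⟩
  sumSubsets n (f ∘ (false ∷_)) + sumSubsets n (f ∘ (true ∷_))
    ≡⟨ sym (sumSubsets-suc f) ⟩
  sumSubsets (suc n) f ∎

-- Mean₃₂ n f k: k is 32 times the mean of f over the subsets of [n]; the factor 32 keeps every
-- mean computed below integral.
record Mean₃₂ (n : ℕ) (f : Subset n → ℤ) (k : ℤ) : Set where
  constructor mean₃₂
  field sum-mean : + 32 * sumSubsets n f ≡ + (2 ^ n) * k
open Mean₃₂

mean-cong : {f g : Subset n → ℤ} {k : ℤ} →
            (∀ T → f T ≡ g T) → Mean₃₂ n g k → Mean₃₂ n f k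
mean-cong f≗g (mean₃₂ mean-g) = mean₃₂ (trans (cong (+ 32 *_) (sumSubsets-cong f≗g)) mean-g)

mean-suc : {f : Subset (suc n) → ℤ} {k₀ k₁ k : ℤ} →
           Mean₃₂ n (f ∘ (false ∷_)) k₀ → Mean₃₂ n (f ∘ (true ∷_)) k₁ → k₀ + k₁ ≡ + 2 * k →
           Mean₃₂ (suc n) f k
mean-suc {n} {f} {k₀} {k₁} {k} (mean₃₂ mean₀) (mean₃₂ mean₁) k₀+k₁≡2k =
  mean₃₂ (begin
  + 32 * sumSubsets (suc n) f   ≡⟨ cong (+ 32 *_) (sumSubsets-suc f) ⟩
  + 32 * (Σ₀ + Σ₁)             ≡⟨ *-distribˡ-+ (+ 32) Σ₀ Σ₁ ⟩
  + 32 * Σ₀ + + 32 * Σ₁         ≡⟨ cong₂ _+_ mean₀ mean₁ ⟩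
  N * k₀ + N * k₁               ≡⟨ sym (*-distribˡ-+ N k₀ k₁) ⟩
  N * (k₀ + k₁)                 ≡⟨ cong (N *_) k₀+k₁≡2k ⟩
  N * (+ 2 * k)                 ≡⟨ sym (*-assoc N (+ 2) k) ⟩
  N * + 2 * k                   ≡⟨ cong (_* k) (trans (*-comm N (+ 2)) (sym (pos-* 2 (2 ^ n)))) ⟩
  + (2 ^ suc n) * k             ∎)
  where
  N  = + (2 ^ n)
  Σ₀ = sumSubsets n (f ∘ (false ∷_))
  Σ₁ = sumSubsets n (f ∘ (true ∷_))

mean-zero : Mean₃₂ n (λ _ → + 0) (+ 0)
mean-zero {zero}  = mean₃₂ refl
mean-zero {suc n} = mean-suc mean-zero mean-zero refl

mean-+ : {f g : Subset n → ℤ} {k l : ℤ} →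
         Mean₃₂ n f k → Mean₃₂ n g l → Mean₃₂ n (λ T → f T + g T) (k + l)
mean-+ {n} {f} {g} {k} {l} (mean₃₂ mean-f) (mean₃₂ mean-g) = mean₃₂ (begin
  + 32 * sumSubsets n (λ T → f T + g T)  ≡⟨ cong (+ 32 *_) (sumSubsets-+ f g) ⟩
  + 32 * (Σf + Σg)                       ≡⟨ *-distribˡ-+ (+ 32) Σf Σg ⟩
  + 32 * Σf + + 32 * Σg                  ≡⟨ cong₂ _+_ mean-f mean-g ⟩
  + (2 ^ n) * k + + (2 ^ n) * l          ≡⟨ sym (*-distribˡ-+ (+ (2 ^ n)) k l) ⟩
  + (2 ^ n) * (k + l)                    ∎)
  where
  Σf = sumSubsets n f
  Σg = sumSubsets n g

mean-- : {f g : Subset n → ℤ} {k l : ℤ} →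
         Mean₃₂ n f k → Mean₃₂ n g l → Mean₃₂ n (λ T → f T - g T) (k - l)
mean-- {n} {f} {g} {k} {l} (mean₃₂ mean-f) (mean₃₂ mean-g) = mean₃₂ (begin
  + 32 * sumSubsets n (λ T → f T - g T)  ≡⟨ cong (+ 32 *_) (sumSubsets-- f g) ⟩
  + 32 * (Σf - Σg)                       ≡⟨ *-distribˡ-- (+ 32) Σf Σg ⟩
  + 32 * Σf - + 32 * Σg                  ≡⟨ cong₂ _-_ mean-f mean-g ⟩
  + (2 ^ n) * k - + (2 ^ n) * l          ≡⟨ sym (*-distribˡ-- (+ (2 ^ n)) k l) ⟩
  + (2 ^ n) * (k - l)                    ∎)
  where
  Σf = sumSubsets n f
  Σg = sumSubsets n g
  *-distribˡ-- : ∀ a b c → a * (b - c) ≡ a * b - a * c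
  *-distribˡ-- = solve-∀

mean-∘∁ : {f : Subset n → ℤ} {k : ℤ} → Mean₃₂ n f k → Mean₃₂ n (f ∘ ∁) k
mean-∘∁ {f = f} (mean₃₂ mean-f) = mean₃₂ (trans (cong (+ 32 *_) (sumSubsets-∁ f)) mean-f)

-- Polynomials in a = |S ∩ T| and c = |T|

C₂-suc : ∀ a → + (suc a C 2) ≡ + (a C 2) + + a
C₂-suc a = cong +_ (begin
  suc a C 2           ≡⟨ sym (nCk+nC[k+1]≡[n+1]C[k+1] a 1) ⟩
  a C 1 ℕ.+ a C 2     ≡⟨ cong (ℕ._+ a C 2) (nC1≡n a) ⟩
  a ℕ.+ a C 2         ≡⟨ ℕ.+-comm a (a C 2) ⟩
  a C 2 ℕ.+ a         ∎)

record Coeffs : Set where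
  constructor coeffs
  field α β γ δ ε ζ : ℤ
open Coeffs

byCoeffs : {Q : Coeffs → Set} → (∀ α β γ δ ε ζ → Q (coeffs α β γ δ ε ζ)) → ∀ P → Q P
byCoeffs q P = q (α P) (β P) (γ P) (δ P) (ε P) (ζ P)

-- The argument A stands for C(a, 2). The INLINE pragmas in this section let the ring solver
-- see through these definitions.
polynomial : Coeffs → (a c A : ℤ) → ℤ
polynomial P a c A = α P + β P * c + γ P * a + δ P * a * c + ε P * A + ζ P * A * c
{-# INLINE polynomial #-}

shift-ac : Coeffs → Coeffs
shift-ac P = coeffs (α P + β P + γ P + δ P) (β P + δ P) (γ P + δ P + ε P + ζ P) (δ P + ζ P)
                    (ε P + ζ P) (ζ P)
{-# INLINE shift-ac #-}

shift-c : Coeffs → Coeffs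
shift-c P = coeffs (α P + β P) (β P) (γ P + δ P) (δ P) (ε P + ζ P) (ζ P)
{-# INLINE shift-c #-}

polynomial-shift-ac : ∀ P a c A →
                      polynomial P (+ 1 + a) (+ 1 + c) (A + a) ≡ polynomial (shift-ac P) a c A
polynomial-shift-ac = byCoeffs solve-∀

polynomial-shift-c : ∀ P a c A → polynomial P a (+ 1 + c) A ≡ polynomial (shift-c P) a c A
polynomial-shift-c = byCoeffs solve-∀

term : Coeffs → Subset n → Subset n → ℤ
term P S T = polynomial P (+ ∣ S ∩ T ∣) (+ ∣ T ∣) (+ (∣ S ∩ T ∣ C 2))

term-shift-ac : ∀ P (S T : Subset n) → term P (true ∷ S) (true ∷ T) ≡ term (shift-ac P) S T
term-shift-ac P S T =
  trans (cong (polynomial P (+ suc ∣ S ∩ T ∣) (+ suc ∣ T ∣)) (C₂-suc ∣ S ∩ T ∣))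
        (polynomial-shift-ac P (+ ∣ S ∩ T ∣) (+ ∣ T ∣) (+ (∣ S ∩ T ∣ C 2)))

term-shift-c : ∀ P (S T : Subset n) → term P (false ∷ S) (true ∷ T) ≡ term (shift-c P) S T
term-shift-c P S T = polynomial-shift-c P (+ ∣ S ∩ T ∣) (+ ∣ T ∣) (+ (∣ S ∩ T ∣ C 2))

-- 32 times the mean of term P S over T ⊆ [n], when |S| = p.
mean : Coeffs → (n p : ℤ) → ℤ
mean P n p = + 32 * α P + + 16 * β P * n + + 16 * γ P * p + + 8 * δ P * p * (n + + 1)
           + + 4 * ε P * p * (p - + 1) + + 2 * ζ P * p * (p - + 1) * (n + + 2)
{-# INLINE mean #-}

-- 32 times the mean of T(x) · term P S T over T ⊆ [n], when |S| = p and S(x) = e.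
markedMean : Coeffs → (n p e : ℤ) → ℤ
markedMean P n p e =
  + 16 * α P + + 8 * β P * (n + + 1) + + 8 * γ P * (p + e)
  + δ P * (+ 8 * e * (n + + 1) + + 4 * (p - e) * (n + + 2))
  + ε P * (+ 4 * e * (p - + 1) + + 2 * p * (p - + 1))
  + ζ P * (+ 4 * e * (p - + 1) * (n + + 2) + (p * (p - + 1) - + 2 * e * (p - + 1)) * (n + + 3))
{-# INLINE markedMean #-}

mean-empty : ∀ P → + 32 * (polynomial P (+ 0) (+ 0) (+ 0) + + 0) ≡ + 1 * mean P (+ 0) (+ 0)
mean-empty = byCoeffs solve-∀

mean-shift-ac : ∀ P n p → mean P n p + mean (shift-ac P) n p ≡ + 2 * mean P (+ 1 + n) (+ 1 + p)
mean-shift-ac = byCoeffs solve-∀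

mean-shift-c : ∀ P n p → mean P n p + mean (shift-c P) n p ≡ + 2 * mean P (+ 1 + n) p
mean-shift-c = byCoeffs solve-∀

markedMean-shift-ac : ∀ P n p e →
  markedMean P n p e + markedMean (shift-ac P) n p e ≡ + 2 * markedMean P (+ 1 + n) (+ 1 + p) e
markedMean-shift-ac = byCoeffs solve-∀

markedMean-shift-c : ∀ P n p e →
  markedMean P n p e + markedMean (shift-c P) n p e ≡ + 2 * markedMean P (+ 1 + n) p e
markedMean-shift-c = byCoeffs solve-∀

markedMean-here-ac : ∀ P n p →
  + 0 + mean (shift-ac P) n p ≡ + 2 * markedMean P (+ 1 + n) (+ 1 + p) (+ 1)
markedMean-here-ac = byCoeffs solve-∀

markedMean-here-c : ∀ P n p → + 0 + mean (shift-c P) n p ≡ + 2 * markedMean P (+ 1 + n) p (+ 0)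
markedMean-here-c = byCoeffs solve-∀

mean-term : ∀ n (S : Subset n) P → Mean₃₂ n (term P S) (mean P (+ n) (+ ∣ S ∣))
mean-term zero    []          P = mean₃₂ (mean-empty P)
mean-term (suc n) (true ∷ S)  P =
  mean-suc (mean-term n S P) (mean-cong (term-shift-ac P S) (mean-term n S (shift-ac P)))
           (mean-shift-ac P (+ n) (+ ∣ S ∣))
mean-term (suc n) (false ∷ S) P =
  mean-suc (mean-term n S P) (mean-cong (term-shift-c P S) (mean-term n S (shift-c P)))
           (mean-shift-c P (+ n) (+ ∣ S ∣))

-- At the coordinate x only the subsets T ∋ x contribute, and these carry an unmarked sum.
mean-markedTerm : ∀ n (S : Subset n) (x : Fin n) P →
                  Mean₃₂ n (λ T → ind T x * term P S T) (markedMean P (+ n) (+ ∣ S ∣) (ind S x))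
mean-markedTerm (suc n) (true ∷ S)  fzero P =
  mean-suc mean-zero
           (mean-cong (λ T → trans (*-identityˡ _) (term-shift-ac P S T))
                      (mean-term n S (shift-ac P)))
           (markedMean-here-ac P (+ n) (+ ∣ S ∣))
mean-markedTerm (suc n) (false ∷ S) fzero P =
  mean-suc mean-zero
           (mean-cong (λ T → trans (*-identityˡ _) (term-shift-c P S T))
                      (mean-term n S (shift-c P)))
           (markedMean-here-c P (+ n) (+ ∣ S ∣))
mean-markedTerm (suc n) (true ∷ S)  (fsuc x) P =
  mean-suc (mean-markedTerm n S x P)
           (mean-cong (λ T → cong (ind T x *_) (term-shift-ac P S T))
                      (mean-markedTerm n S x (shift-ac P)))
           (markedMean-shift-ac P (+ n) (+ ∣ S ∣) (ind S x))
mean-markedTerm (suc n) (false ∷ S) (fsuc x) P =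
  mean-suc (mean-markedTerm n S x P)
           (mean-cong (λ T → cong (ind T x *_) (term-shift-c P S T))
                      (mean-markedTerm n S x (shift-c P)))
           (markedMean-shift-c P (+ n) (+ ∣ S ∣) (ind S x))

ind-∁ : (T : Subset n) (u : Fin n) → ind (∁ T) u ≡ + 1 - ind T u
ind-∁ (true ∷ T)  fzero    = refl
ind-∁ (false ∷ T) fzero    = refl
ind-∁ (_ ∷ T)     (fsuc u) = ind-∁ T u

∣∁T∣≡n-∣T∣ : (T : Subset n) → + ∣ ∁ T ∣ ≡ + n - + ∣ T ∣
∣∁T∣≡n-∣T∣ {n} T = begin
  + ∣ ∁ T ∣         ≡⟨ cong +_ (∣∁p∣≡n∸∣p∣ T) ⟩
  + (n ∸ ∣ T ∣)     ≡⟨ sym (⊖-≥ (∣p∣≤n T)) ⟩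
  n ⊖ ∣ T ∣          ≡⟨ sym (m-n≡m⊖n n ∣ T ∣) ⟩
  + n - + ∣ T ∣     ∎

V-∁ : ∀ r (x y : Fin r) T → V r x y (∁ T) ≡ V r x y T
V-∁ r x y T = begin
  (+ r - + 2 * + ∣ ∁ T ∣) * (ind (∁ T) x - ind (∁ T) y)
    ≡⟨ cong₂ (λ t d → (+ r - + 2 * t) * d)
             (∣∁T∣≡n-∣T∣ T) (cong₂ _-_ (ind-∁ T x) (ind-∁ T y)) ⟩
  (+ r - + 2 * (+ r - + ∣ T ∣)) * ((+ 1 - ind T x) - (+ 1 - ind T y))
    ≡⟨ complement (+ r) (+ ∣ T ∣) (ind T x) (ind T y) ⟩
  (+ r - + 2 * + ∣ T ∣) * (ind T x - ind T y) ∎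
  where
  complement : ∀ r t ex ey →
    (r - + 2 * (r - t)) * ((+ 1 - ex) - (+ 1 - ey)) ≡ (r - + 2 * t) * (ex - ey)
  complement = solve-∀

halfTerm : ∀ r → Fin r → Fin r → Subset r → Subset r → ℤ
halfTerm r x y S T = + (∣ S ∩ T ∣ C 2) * V r x y T

MV-term-halves : ∀ r (x y : Fin r) S T →
  M r S T * V r x y T ≡ halfTerm r x y S T + (halfTerm r x y (∁ S) ∘ ∁) T
MV-term-halves r x y S T =
  trans (*-distribʳ-+ (V r x y T) (+ (∣ S ∩ T ∣ C 2)) (+ (∣ ∁ S ∩ ∁ T ∣ C 2)))
        (cong (λ v → halfTerm r x y S T + + (∣ ∁ S ∩ ∁ T ∣ C 2) * v) (sym (V-∁ r x y T)))

-- C(a, 2) (r − 2c)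
coeffsV : ℤ → Coeffs
coeffsV r = coeffs (+ 0) (+ 0) (+ 0) (+ 0) r (- + 2)
{-# INLINE coeffsV #-}

halfTerm-marked : ∀ r (x y : Fin r) S T →
  halfTerm r x y S T ≡ ind T x * term (coeffsV (+ r)) S T - ind T y * term (coeffsV (+ r)) S T
halfTerm-marked r x y S T =
  expand (+ r) (+ ∣ S ∩ T ∣) (+ ∣ T ∣) (+ (∣ S ∩ T ∣ C 2)) (ind T x) (ind T y)
  where
  expand : ∀ r a c A ex ey → A * ((r - + 2 * c) * (ex - ey))
                             ≡ ex * polynomial (coeffsV r) a c A - ey * polynomial (coeffsV r) a c A
  expand = solve-∀

markedMean-coeffsV : ∀ r p ex ey →
  markedMean (coeffsV r) r p ex - markedMean (coeffsV r) r p ey ≡ + 4 * ((+ 1 - p) * (ex - ey))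
markedMean-coeffsV = solve-∀

halfMean : ∀ r → Fin r → Fin r → Subset r → ℤ
halfMean r x y S = + 4 * ((+ 1 - + ∣ S ∣) * (ind S x - ind S y))

mean-halfTerm : ∀ r (x y : Fin r) S → Mean₃₂ r (halfTerm r x y S) (halfMean r x y S)
mean-halfTerm r x y S =
  subst (Mean₃₂ r (halfTerm r x y S)) (markedMean-coeffsV (+ r) (+ ∣ S ∣) (ind S x) (ind S y))
        (mean-cong (halfTerm-marked r x y S)
                   (mean-- (mean-markedTerm r S x (coeffsV (+ r))) (mean-markedTerm r S y (coeffsV (+ r)))))

halfMean-∁ : ∀ r (x y : Fin r) S → halfMean r x y S + halfMean r x y (∁ S) ≡ + 4 * V r x y S
halfMean-∁ r x y S = begin
  halfMean r x y S + halfMean r x y (∁ S)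
    ≡⟨ cong (_+_ (halfMean r x y S)) (cong₂ (λ t d → + 4 * ((+ 1 - t) * d))
                                            (∣∁T∣≡n-∣T∣ S) (cong₂ _-_ (ind-∁ S x) (ind-∁ S y))) ⟩
  halfMean r x y S + + 4 * ((+ 1 - (+ r - + ∣ S ∣)) * ((+ 1 - ind S x) - (+ 1 - ind S y)))
    ≡⟨ add (+ r) (+ ∣ S ∣) (ind S x) (ind S y) ⟩
  + 4 * V r x y S ∎
  where
  add : ∀ r p ex ey →
    + 4 * ((+ 1 - p) * (ex - ey)) + + 4 * ((+ 1 - (r - p)) * ((+ 1 - ex) - (+ 1 - ey)))
    ≡ + 4 * ((r - + 2 * p) * (ex - ey))
  add = solve-∀

mean-MV : ∀ r (x y : Fin r) S → Mean₃₂ r (λ T → M r S T * V r x y T) (+ 4 * V r x y S)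
mean-MV r x y S =
  subst (Mean₃₂ r _) (halfMean-∁ r x y S)
        (mean-cong (MV-term-halves r x y S)
                   (mean-+ (mean-halfTerm r x y S) (mean-∘∁ (mean-halfTerm r x y (∁ S)))))

MV-V : ∀ r (x y : Fin (3 ℕ.+ r)) S →
       MV (3 ℕ.+ r) (V (3 ℕ.+ r) x y) S ≡ + (2 ^ r) * V (3 ℕ.+ r) x y S
MV-V r x y S = *-cancelˡ-≡ (+ 32) _ _ (begin
  + 32 * MV (3 ℕ.+ r) (V (3 ℕ.+ r) x y) S
    ≡⟨ sum-mean (mean-MV (3 ℕ.+ r) x y S) ⟩
  + (2 ^ (3 ℕ.+ r)) * (+ 4 * v)
    ≡⟨ cong (_* (+ 4 * v)) (trans (cong +_ (ℕ.^-distribˡ-+-* 2 3 r)) (pos-* 8 (2 ^ r))) ⟩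
  + 8 * + (2 ^ r) * (+ 4 * v)
    ≡⟨ regroup (+ (2 ^ r)) v ⟩
  + 32 * (+ (2 ^ r) * v) ∎)
  where
  v = V (3 ℕ.+ r) x y S
  regroup : ∀ a v → + 8 * a * (+ 4 * v) ≡ + 32 * (a * v)
  regroup = solve-∀

ind-⁅x⁆-self : (x : Fin n) → ind ⁅ x ⁆ x ≡ + 1
ind-⁅x⁆-self fzero    = refl
ind-⁅x⁆-self (fsuc x) = ind-⁅x⁆-self x

ind-⊥ : (u : Fin n) → ind ⊥ u ≡ + 0
ind-⊥ fzero    = refl
ind-⊥ (fsuc u) = ind-⊥ u

ind-⁅x⁆-other : (x y : Fin n) → x ≢ y → ind ⁅ x ⁆ y ≡ + 0
ind-⁅x⁆-other fzero    fzero    x≢y = ⊥-elim (x≢y refl)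
ind-⁅x⁆-other fzero    (fsuc y) _   = ind-⊥ y
ind-⁅x⁆-other (fsuc x) fzero    _   = refl
ind-⁅x⁆-other (fsuc x) (fsuc y) x≢y = ind-⁅x⁆-other x y (x≢y ∘ cong fsuc)

V-⁅x⁆ : ∀ r (x y : Fin r) → x ≢ y → V r x y ⁅ x ⁆ ≡ + r - + 2
V-⁅x⁆ r x y x≢y
  rewrite ∣⁅x⁆∣≡1 x | ind-⁅x⁆-self x | ind-⁅x⁆-other x y x≢y = *-identityʳ (+ r - + 2)

proposition6 : (r : ℕ) → 4 ≤ r → (x y : Fin r) → x ≢ y →
    ((S : Subset r) → MV r (V r x y) S ≡ (+ (2 ^ (r ∸ 3))) * V r x y S)
    × ∃ (λ (T : Subset r) → V r x y T ≢ + 0)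
proposition6 (suc (suc (suc r))) (s≤s (s≤s (s≤s _))) x y x≢y =
  MV-V r x y , ⁅ x ⁆ , λ V≡0 → case trans (sym (V-⁅x⁆ (3 ℕ.+ r) x y x≢y)) V≡0 of λ ()
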